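{- Let $T$ be a finite rooted hypertree with root $\gamma$ whose vertices carry pairwise distinct positive weights, $W_v$ denoting the weight of $v$. Then $$S_T(\gamma)=W_\gamma\, I(\gamma\in\mathcal{I}(T)),$$ where $I$ denotes the indicator function.
   Context: A hypertree is a connected linear hypergraph (any two distinct edges share at most one vertex) containing no Berge cycle (no $k\ge 3$ distinct edges $e_1,\dots,e_k$ and distinct vertices $v_1,\dots,v_k$ with $v_k,v_1\in e_1$, $v_{i-1},v_i\in e_i$ for $2\le i\le k$). In a rooted hypertree, each edge $e$ has a unique vertex closest to the root; $e$ is a descending edge of that vertex. $DE(v)$ is the set of descending edges of $v$; $v$ is a leaf if $DE(v)=\emptyset$. The bonus function $S_T:V(T)\to\mathbb{R}$ is defined recursively: $S_T(v)=W_v$ if $v$ is a leaf, and otherwise $S_T(v)=W_v\prod_{e\in DE(v)} I\big(W_v>\min_{u\in e,\,u\ne v} S_T(u)\big)$. $\mathcal{I}(T)$ is produced as follows: maintain a selected set $S$ (initially empty) and a remaining set $R$ (initially $V(T)$); while $R\neq\emptyset$, take the $v\in R$ of largest weight, add it to $S$, remove it from $R$, and remove from $R$ every $w$ for which some edge $e$ satisfies $e\subseteq S\cup\{w\}$; then $\mathcal{I}(T)=S$.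
   Formalization: The vertex weights are positive rationals rather than real numbers, so the bonus function $S_T$ also takes rational values. -}

module Defs where

open import Data.Nat using (ℕ; zero; suc; _≤_; _<_)
open import Data.Fin using (Fin; zero; suc; fromℕ; inject₁)
open import Data.Fin.Subset using (Subset; _∈_; _∉_; _⊆_; _∪_; ⁅_⁆; ∣_∣; ⊤; ⊥)
open import Data.Fin.Subset.Properties using (_∈?_; _⊆?_)
open import Data.Fin.Properties using (any?)
open import Data.Bool using (Bool; true; false; if_then_else_; _∧_; not)
open import Data.Maybe using (Maybe; just; nothing)
open import Data.List using (List; []; _∷_; filter; allFin)
open import Data.Vec using (tabulate; lookup)
open import Data.Product using (Σ; ∃; _×_; _,_)
open import Data.Rational using (ℚ; 0ℚ; 1ℚ) renaming (_<_ to _<ℚ_; _*_ to _*ℚ_)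
open import Data.Rational.Properties using (_<?_)
open import Data.Fin.Properties using (_≟_)
open import Relation.Nullary using (¬_; Dec; yes; no; ⌊_⌋)
open import Relation.Binary.PropositionalEquality using (_≡_; _≢_)
open import Function.Definitions using (Injective)

Hypergraph : ℕ → ℕ → Set
Hypergraph n m = Fin m → Subset n

module _ {n m : ℕ} (E : Hypergraph n m) where

  -- every edge has at least two vertices (standard hypergraph convention;
  -- needed for  min_{u ∈ e, u ≠ v}  to make sense)
  EdgesNontrivial : Set
  EdgesNontrivial = ∀ i → 2 ≤ ∣ E i ∣

  Linear : Set
  Linear = ∀ i j → i ≢ j → ∀ u v →
           u ∈ E i → v ∈ E i → u ∈ E j → v ∈ E j → u ≡ v

  data Conn (u : Fin n) : Fin n → Set where
    here : Conn u u
    step : ∀ {x y} (i : Fin m) → Conn u x → x ∈ E i → y ∈ E i → Conn u y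

  Connected : Set
  Connected = ∀ u v → Conn u v

  -- A Berge cycle of length k = 3 + j, 0-indexed: distinct edges e₀..e_{k-1},
  -- distinct vertices v₀..v_{k-1} with v_{k-1}, v₀ ∈ e₀ and
  -- v_{i-1}, v_i ∈ e_i for 1 ≤ i ≤ k-1.
  BergeCycle : Set
  BergeCycle =
    Σ ℕ λ j →
    Σ (Fin (suc (suc (suc j))) → Fin m) λ es →
    Σ (Fin (suc (suc (suc j))) → Fin n) λ vs →
      Injective _≡_ _≡_ es × Injective _≡_ _≡_ vs ×
      vs (fromℕ (suc (suc j))) ∈ E (es zero) × vs zero ∈ E (es zero) ×
      (∀ (i : Fin (suc (suc j))) →
         vs (inject₁ i) ∈ E (es (suc i)) × vs (suc i) ∈ E (es (suc i)))

  IsHypertree : Set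
  IsHypertree = EdgesNontrivial × Linear × Connected × ¬ BergeCycle

  data Walk (γ : Fin n) : ℕ → Fin n → Set where
    start : Walk γ 0 γ
    step  : ∀ {d x y} (i : Fin m) → Walk γ d x → x ∈ E i → y ∈ E i →
            Walk γ (suc d) y

  -- dist(γ,v) < dist(γ,u)
  Closer : Fin n → Fin n → Fin n → Set
  Closer γ v u = ∀ d → Walk γ d u → Σ ℕ λ d' → d' < d × Walk γ d' v

  Descending : Fin n → Fin n → Fin m → Set
  Descending γ v i = v ∈ E i × (∀ u → u ∈ E i → u ≢ v → Closer γ v u)

  -- The condition  ∏_{e ∈ DE(v)} I(W_v > min_{u ∈ e, u ≠ v} S(u)) = 1
  BonusCond : Fin n → (Fin n → ℚ) → (Fin n → ℚ) → Fin n → Set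
  BonusCond γ W S v = ∀ i → Descending γ v i →
                      ∃ λ u → u ∈ E i × u ≢ v × S u <ℚ W v

  -- S is the bonus function S_T: it satisfies the recursive defining
  -- equations S(v) = W_v · ∏_{e ∈ DE(v)} I(W_v > min_{u∈e∖v} S(u))
  -- (for leaves the product is empty, so S(v) = W_v).
  IsBonus : Fin n → (Fin n → ℚ) → (Fin n → ℚ) → Set
  IsBonus γ W S = ∀ v → (BonusCond γ W S v → S v ≡ W v)
                      × (¬ BonusCond γ W S v → S v ≡ 0ℚ)

  maxBy : (Fin n → ℚ) → List (Fin n) → Maybe (Fin n)
  maxBy W [] = nothing
  maxBy W (x ∷ xs) with maxBy W xs
  ... | nothing = just x
  ... | just y  = if ⌊ W y <? W x ⌋ then just x else just y

  argmax : (Fin n → ℚ) → Subset n → Maybe (Fin n)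
  argmax W R = maxBy W (filter (_∈? R) (allFin n))

  newR : Subset n → Subset n → Fin n → Subset n
  newR S' R v = tabulate λ w →
    lookup R w ∧ not ⌊ w ≟ v ⌋ ∧ not ⌊ any? (λ i → E i ⊆? (S' ∪ ⁅ w ⁆)) ⌋

  -- iterate with fuel (each round removes at least one vertex from R,
  -- so n rounds suffice to empty R)
  greedy : (Fin n → ℚ) → ℕ → Subset n → Subset n → Subset n
  greedy W zero    S R = S
  greedy W (suc f) S R with argmax W R
  ... | nothing = S
  ... | just v  = greedy W f (S ∪ ⁅ v ⁆) (newR (S ∪ ⁅ v ⁆) R v)

  𝓘 : (Fin n → ℚ) → Subset n
  𝓘 W = greedy W n ⊥ ⊤

indicator : ∀ {n} (γ : Fin n) (X : Subset n) → ℚ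
indicator γ X = if ⌊ γ ∈? X ⌋ then 1ℚ else 0ℚ

{-# OPTIONS --safe #-}
module Submission where

-- Levels (distance from the root) organise the hypertree: linearity and acyclicity force every
-- vertex to have exactly one non-descending edge, its edge towards the root, because two such
-- edges, or two lowest vertices in one edge, give a Berge path that can be pushed down level by
-- level until it closes a Berge cycle.  The greedy set 𝓘 is stable: v is selected iff no edge
-- through v has all its other vertices selected and heavier.  The bonus condition at v looks only
-- at descending edges and, in effect, only at heavier vertices, so by induction from heavy to
-- light: v ∈ 𝓘 implies the bonus condition at v, and the converse holds whenever the edge of v
-- towards the root does not block v.  At the root every edge is descending, so S(γ) = W_γ I(γ ∈ 𝓘).
-- The same locality makes the recursion defining S well founded, which gives existence.

open import Defs
open import Data.Bool using (Bool; T; if_then_else_)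
open import Data.Bool.Properties using (T-≡; T-∧)
open import Data.Empty using (⊥; ⊥-elim)
open import Data.Fin using (Fin; zero; suc; fromℕ; inject₁; opposite)
open import Data.Fin.Induction using (spo-wellFounded)
open import Data.Fin.Properties
  using (any?; all?; ¬∀⟶∃¬; opposite-involutive; 0≢1+n) renaming (_≟_ to _≟ᶠ_)
open import Data.Fin.Subset using (Subset; _∈_; _∉_; _⊆_; _∪_; ⁅_⁆; ∣_∣; ⊤) renaming (⊥ to ∅)
open import Data.Fin.Subset.Properties
  using (_∈?_; _⊆?_; ∈⊤; ∉⊥; x∈⁅x⁆; x∈⁅y⁆⇒x≡y; x∈p∪q⁻; p⊆p∪q; q⊆p∪q; ∣⁅x⁆∣≡1; ∣⊤∣≡n;
         p⊆q⇒∣p∣≤∣q∣; p⊂q⇒∣p∣<∣q∣; x∈p⇒∣p-x∣<∣p∣)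
open import Data.List as List using (filter; allFin)
open import Data.List.Membership.Propositional using () renaming (_∈_ to _∈ₗ_)
open import Data.List.Membership.Propositional.Properties using (∈-filter⁺; ∈-filter⁻; ∈-allFin)
open import Data.List.Relation.Unary.Any using (here; there)
open import Data.Maybe using (Maybe; just; nothing)
open import Data.Nat as ℕ using (ℕ; zero; suc; z≤n; s≤s; s≤s⁻¹)
import Data.Nat.Properties as ℕ
open import Data.Product using (Σ; ∃; _×_; _,_; proj₁; proj₂; map₁)
open import Data.Rational using (ℚ; 0ℚ; _<_; _≤_; _*_)
import Data.Rational.Properties as ℚ
open import Data.Sum as Sum using (_⊎_; inj₁; inj₂; [_,_]′)
open import Data.Vec using (tabulate; lookup)
open import Data.Vec.Functional using (Vector; _∷_)
open import Data.Vec.Properties using (lookup∘tabulate; []=⇒lookup; lookup⇒[]=)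
open import Function using (_∘_; id)
open import Function.Bundles using (Equivalence; mk⇔)
open import Function.Definitions using (Injective)
open import Induction.WellFounded using (WellFounded; WfRec; module All; module FixPoint)
open import Relation.Binary using (Rel; Decidable; tri<; tri≈; tri>)
import Relation.Binary.Construct.Flip.Ord as Flip
import Relation.Binary.Construct.On as On
open import Relation.Binary.PropositionalEquality using (_≡_; _≢_; refl; sym; trans; cong; subst)
open import Relation.Nullary using (¬_; Dec; yes; no; does; contradiction)
open import Relation.Nullary.Decidable
  using (map′; _×-dec_; _→-dec_; ¬?; decidable-stable; toWitnessFalse; fromWitnessFalse;
         does-⇔; dec-true; dec-false)

least-witness : ∀ {p} {P : ℕ → Set p} → (∀ d → Dec (P d)) → ∀ {d} → P d →
                Σ ℕ λ k → P k × (∀ {d} → P d → k ℕ.≤ d)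
least-witness P? {d} Pd with P? 0
... | yes P0 = 0 , P0 , λ _ → z≤n
least-witness P? {zero} Pd | no ¬P0 = contradiction Pd ¬P0
least-witness P? {suc d} Pd | no ¬P0 with least-witness (P? ∘ suc) Pd
... | k , Pk , k-least =
  suc k , Pk , λ { {zero} P0 → contradiction P0 ¬P0 ; {suc d} Pd → s≤s (k-least Pd) }

∷-injective : ∀ {a} {A : Set a} {k} {x : A} {xs : Vector A k} →
              (∀ i → xs i ≢ x) → Injective _≡_ _≡_ xs → Injective _≡_ _≡_ (x ∷ xs)
∷-injective x∉xs xs-inj {zero}  {zero}  _  = refl
∷-injective x∉xs xs-inj {zero}  {suc j} eq = contradiction (sym eq) (x∉xs j)
∷-injective x∉xs xs-inj {suc i} {zero}  eq = contradiction eq (x∉xs i)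
∷-injective x∉xs xs-inj {suc i} {suc j} eq = cong suc (xs-inj eq)

opposite-inject₁ : ∀ {k} (i : Fin k) → opposite (inject₁ i) ≡ suc (opposite i)
opposite-inject₁ {suc k} zero    = refl
opposite-inject₁ {suc k} (suc i) = cong inject₁ (opposite-inject₁ i)

opposite-fromℕ : ∀ k → opposite (fromℕ k) ≡ zero
opposite-fromℕ zero    = refl
opposite-fromℕ (suc k) = cong inject₁ (opposite-fromℕ k)

opposite-injective : ∀ {k} → Injective _≡_ _≡_ (opposite {k})
opposite-injective {_} {i} {j} eq =
  trans (sym (opposite-involutive i)) (trans (cong opposite eq) (opposite-involutive j))

module _ {a b ℓ} {A : Set a} {B : Set b} {_⊏_ : Rel A ℓ}
         (wf : WellFounded _⊏_) (_⊏?_ : Decidable _⊏_) where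

  guarded-fixpoint : B → (F : (A → B) → A → B) →
                     (∀ {f g} x → (∀ {y} → y ⊏ x → f y ≡ g y) → F f x ≡ F g x) →
                     Σ (A → B) λ f → ∀ x → f x ≡ F f x
  guarded-fixpoint default F F-guarded = fix , λ x → trans unfold-wfRec (F-guarded x extend-fix)
    where
    extend : ∀ {x} → WfRec _⊏_ (λ _ → B) x → A → B
    extend {x} IH y with y ⊏? x
    ... | yes y⊏x = IH y⊏x
    ... | no _    = default

    extend-cong : ∀ {x} {IH IH′ : WfRec _⊏_ (λ _ → B) x} → (∀ {y} (y⊏x : y ⊏ x) → IH y⊏x ≡ IH′ y⊏x) →
                  ∀ {y} → y ⊏ x → extend IH y ≡ extend IH′ y
    extend-cong {x} IH≡IH′ {y} _ with y ⊏? x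
    ... | yes y⊏x = IH≡IH′ y⊏x
    ... | no _    = refl

    F-extended : ∀ x → WfRec _⊏_ (λ _ → B) x → B
    F-extended x IH = F (extend IH) x

    open FixPoint wf (λ _ → B) F-extended (λ x IH≡IH′ → F-guarded x (extend-cong IH≡IH′))

    fix : A → B
    fix = All.wfRec wf _ (λ _ → B) F-extended

    extend-fix : ∀ {x y} → y ⊏ x → extend {x} (λ _ → fix _) y ≡ fix y
    extend-fix {x} {y} y⊏x with y ⊏? x
    ... | yes _   = refl
    ... | no y⋤x = contradiction y⊏x y⋤x

heavier-wellFounded : ∀ {k} (W : Fin k → ℚ) → WellFounded (λ u v → W v < W u)
heavier-wellFounded W =
  spo-wellFounded (On.isStrictPartialOrder W (Flip.isStrictPartialOrder ℚ.<-isStrictPartialOrder))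

weight-< : ∀ {k} {W : Fin k → ℚ} → Injective _≡_ _≡_ W → ∀ {x y} → W x ≤ W y → x ≢ y → W x < W y
weight-< {W = W} W-injective {x} {y} x≤y x≢y with ℚ.<-cmp (W x) (W y)
... | tri< x<y _ _ = x<y
... | tri≈ _ x≡y _ = contradiction (W-injective x≡y) x≢y
... | tri> _ _ y<x = ⊥-elim (ℚ.<-irrefl refl (ℚ.<-≤-trans y<x x≤y))

if-does-elim : ∀ {a b p} {A : Set a} {B : Set b} (P : B → Set p) (d : Dec A) {x y} →
               (A → P x) → (¬ A → P y) → P (if does d then x else y)
if-does-elim P (yes a) Px Py = Px a
if-does-elim P (no ¬a) Px Py = Py ¬a

if-does-cong : ∀ {a b} {A : Set a} {B : Set b} (d : Dec A) {x x′ y : B} →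
               (A → x ≡ x′) → (if does d then x else y) ≡ (if does d then x′ else y)
if-does-cong (yes a) x≡x′ = x≡x′ a
if-does-cong (no _)  x≡x′ = refl

∈⇒T-lookup : ∀ {k} {p : Subset k} {x} → x ∈ p → T (lookup p x)
∈⇒T-lookup x∈p = Equivalence.from T-≡ ([]=⇒lookup x∈p)

T-lookup⇒∈ : ∀ {k} {p : Subset k} {x} → T (lookup p x) → x ∈ p
T-lookup⇒∈ {p = p} {x} t = lookup⇒[]= x p (Equivalence.to T-≡ t)

∈-tabulate⁻ : ∀ {k} {f : Fin k → Bool} {x} → x ∈ tabulate f → T (f x)
∈-tabulate⁻ {f = f} {x} x∈ = subst T (lookup∘tabulate f x) (∈⇒T-lookup x∈)

∈-tabulate⁺ : ∀ {k} {f : Fin k → Bool} {x} → T (f x) → x ∈ tabulate f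
∈-tabulate⁺ {f = f} {x} t = T-lookup⇒∈ (subst T (sym (lookup∘tabulate f x)) t)

∈-∪⁅⁆⁻ : ∀ {k} {S : Subset k} {v x} → x ∈ S ∪ ⁅ v ⁆ → x ∈ S ⊎ x ≡ v
∈-∪⁅⁆⁻ {S = S} {v} x∈ = Sum.map₂ (x∈⁅y⁆⇒x≡y v) (x∈p∪q⁻ S ⁅ v ⁆ x∈)

module _ {n m : ℕ} (E : Hypergraph n m) where

  record Path (r : ℕ) : Set where
    field
      vertex           : Fin (suc r) → Fin n
      edge             : Fin r → Fin m
      vertex-injective : Injective _≡_ _≡_ vertex
      edge-injective   : Injective _≡_ _≡_ edge
      link             : ∀ i → vertex (inject₁ i) ∈ E (edge i) × vertex (suc i) ∈ E (edge i)

    first : Fin n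
    first = vertex zero

    last : Fin n
    last = vertex (fromℕ r)

  open Path

  point : Fin n → Path 0
  point x = record
    { vertex           = λ _ → x
    ; edge             = λ ()
    ; vertex-injective = λ { {zero} {zero} _ → refl }
    ; edge-injective   = λ { {()} }
    ; link             = λ ()
    }

  cons : ∀ {r} (a : Fin n) (g : Fin m) (P : Path r) → a ∈ E g → first P ∈ E g →
         (∀ i → vertex P i ≢ a) → (∀ i → edge P i ≢ g) → Path (suc r)
  cons a g P a∈g p∈g a∉P g∉P = record
    { vertex           = a ∷ vertex P
    ; edge             = g ∷ edge P
    ; vertex-injective = ∷-injective a∉P (vertex-injective P)
    ; edge-injective   = ∷-injective g∉P (edge-injective P)
    ; link             = λ { zero → a∈g , p∈g ; (suc i) → link P i }
    }

  reverse : ∀ {r} → Path r → Path r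
  reverse P = record
    { vertex           = vertex P ∘ opposite
    ; edge             = edge P ∘ opposite
    ; vertex-injective = opposite-injective ∘ vertex-injective P
    ; edge-injective   = opposite-injective ∘ edge-injective P
    ; link             = λ i → subst (λ k → vertex P k ∈ E (edge P (opposite i)))
                                     (sym (opposite-inject₁ i)) (proj₂ (link P (opposite i)))
                              , proj₁ (link P (opposite i))
    }

  last-reverse : ∀ {r} (P : Path r) → last (reverse P) ≡ first P
  last-reverse {r} P = cong (vertex P) (opposite-fromℕ r)

  no-closed-path : Linear E → ¬ BergeCycle E → ∀ {r} (P : Path (suc r)) (g : Fin m) →
                   first P ∈ E g → last P ∈ E g → (∀ i → edge P i ≢ g) → ⊥
  no-closed-path linear acyclic {zero} P g p∈g q∈g g∉P
    with vertex-injective P (linear (edge P zero) g (g∉P zero) _ _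
                               (proj₁ (link P zero)) (proj₂ (link P zero)) p∈g q∈g)
  ... | ()
  no-closed-path linear acyclic {suc r} P g p∈g q∈g g∉P =
    acyclic (r , g ∷ edge P , vertex P , ∷-injective g∉P (edge-injective P) ,
             vertex-injective P , q∈g , p∈g , link P)

  module Levels (γ : Fin n) (connected : Connected E) where

    walk? : ∀ d v → Dec (Walk E γ d v)
    walk? zero v = map′ (λ { refl → start }) (λ { start → refl }) (v ≟ᶠ γ)
    walk? (suc d) v =
      map′ (λ (x , i , w , x∈ , v∈) → step i w x∈ v∈) (λ { (step i w x∈ v∈) → _ , i , w , x∈ , v∈ })
           (any? λ x → any? λ i → walk? d x ×-dec x ∈? E i ×-dec v ∈? E i)

    conn⇒walk : ∀ {v} → Conn E γ v → ∃ λ d → Walk E γ d v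
    conn⇒walk here              = 0 , start
    conn⇒walk (step i c x∈ v∈) = suc (proj₁ (conn⇒walk c)) , step i (proj₂ (conn⇒walk c)) x∈ v∈

    shortest-walk : ∀ v → Σ ℕ λ d → Walk E γ d v × (∀ {d′} → Walk E γ d′ v → d ℕ.≤ d′)
    shortest-walk v = least-witness (λ d → walk? d v) (proj₂ (conn⇒walk (connected γ v)))

    dist : Fin n → ℕ
    dist v = proj₁ (shortest-walk v)

    dist-walk : ∀ v → Walk E γ (dist v) v
    dist-walk v = proj₁ (proj₂ (shortest-walk v))

    dist-minimal : ∀ {d v} → Walk E γ d v → dist v ℕ.≤ d
    dist-minimal {v = v} = proj₂ (proj₂ (shortest-walk v))

    dist-adjacent : ∀ {x y i} → x ∈ E i → y ∈ E i → dist y ℕ.≤ suc (dist x)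
    dist-adjacent {x} x∈ y∈ = dist-minimal (step _ (dist-walk x) x∈ y∈)

    dist≡0⇒root : ∀ {v} → dist v ≡ 0 → v ≡ γ
    dist≡0⇒root {v} eq with dist v | dist-walk v
    dist≡0⇒root refl | .0 | start = refl

    dist-root : dist γ ≡ 0
    dist-root = ℕ.n≤0⇒n≡0 (dist-minimal start)

    adjacent-level : ∀ {x g j} → x ∈ E g → dist x ≡ suc j → ∀ {u} → u ∈ E g → j ℕ.≤ dist u
    adjacent-level x∈ dx u∈ = s≤s⁻¹ (subst (ℕ._≤ suc _) dx (dist-adjacent u∈ x∈))

    record ParentEdge (j : ℕ) (x : Fin n) (g : Fin m) : Set where
      field
        parent       : Fin n
        child∈       : x ∈ E g
        parent∈      : parent ∈ E g
        parent-level : dist parent ≡ j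

    parent-edge : ∀ {v j} → dist v ≡ suc j → ∃ (ParentEdge j v)
    parent-edge {v} {j} dv = from-walk (subst (λ d → Walk E γ d v) dv (dist-walk v))
      where
      from-walk : Walk E γ (suc j) v → ∃ (ParentEdge j v)
      from-walk (step {x = x} i w x∈ v∈) = i , record
        { parent = x ; child∈ = v∈ ; parent∈ = x∈
        ; parent-level = ℕ.≤-antisym (dist-minimal w)
                           (s≤s⁻¹ (subst (ℕ._≤ suc (dist x)) dv (dist-adjacent x∈ v∈))) }

    closer⇒< : ∀ {v u} → Closer E γ v u → dist v ℕ.< dist u
    closer⇒< {u = u} c with c (dist u) (dist-walk u)
    ... | d , d<du , w = ℕ.≤-<-trans (dist-minimal w) d<du

    <⇒closer : ∀ {v u} → dist v ℕ.< dist u → Closer E γ v u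
    <⇒closer {v} lt d w = dist v , ℕ.<-≤-trans lt (dist-minimal w) , dist-walk v

    descending⁻ : ∀ {v i u} → Descending E γ v i → u ∈ E i → u ≢ v → dist v ℕ.< dist u
    descending⁻ (_ , closer) u∈ u≢v = closer⇒< (closer _ u∈ u≢v)

    descending⁺ : ∀ {v i} → v ∈ E i → (∀ u → u ∈ E i → u ≢ v → dist v ℕ.< dist u) →
                  Descending E γ v i
    descending⁺ v∈ lowest = v∈ , λ u u∈ u≢v → <⇒closer (lowest u u∈ u≢v)

    descending? : ∀ v i → Dec (Descending E γ v i)
    descending? v i =
      map′ (λ (v∈ , lowest) → descending⁺ v∈ lowest) (λ d → proj₁ d , λ u → descending⁻ d)
           (v ∈? E i ×-dec all? λ u → u ∈? E i →-dec ¬? (u ≟ᶠ v) →-dec dist v ℕ.<? dist u)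

    descending-unique : ∀ {v u i} → Descending E γ v i → u ∈ E i → u ≢ v → ¬ Descending E γ u i
    descending-unique dv u∈ u≢v du =
      ℕ.<-asym (descending⁻ dv u∈ u≢v) (descending⁻ du (proj₁ dv) (u≢v ∘ sym))

    dist≡0⇒descending : ∀ {v i} → dist v ≡ 0 → v ∈ E i → Descending E γ v i
    dist≡0⇒descending dv v∈ = descending⁺ v∈ λ u _ u≢v →
      subst (ℕ._< dist u) (sym dv) (ℕ.n≢0⇒n>0 λ du → u≢v (trans (dist≡0⇒root du) (sym (dist≡0⇒root dv))))

    record Above (j : ℕ) {r} (P : Path r) : Set where
      field
        vertex-above : ∀ i → j ℕ.≤ dist (vertex P i)
        edge-above   : ∀ i {u} → u ∈ E (edge P i) → j ℕ.≤ dist u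

    open Above

    above-suc⇒∉ : ∀ {j r a} {P : Path r} → Above (suc j) P → dist a ≡ j → ∀ i → vertex P i ≢ a
    above-suc⇒∉ above da i refl = ℕ.1+n≰n (subst (suc _ ℕ.≤_) da (vertex-above above i))

    above-suc⇒edge∉ : ∀ {j r a g} {P : Path r} → Above (suc j) P → a ∈ E g → dist a ≡ j →
                      ∀ i → edge P i ≢ g
    above-suc⇒edge∉ above a∈ da i refl = ℕ.1+n≰n (subst (suc _ ℕ.≤_) da (edge-above above i a∈))

    above-weaken : ∀ {j r} {P : Path r} → Above (suc j) P → Above j P
    above-weaken above = record
      { vertex-above = λ i → ℕ.<⇒≤ (vertex-above above i)
      ; edge-above   = λ i u∈ → ℕ.<⇒≤ (edge-above above i u∈) }

    above-reverse : ∀ {j r} {P : Path r} → Above j P → Above j (reverse P)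
    above-reverse above = record
      { vertex-above = vertex-above above ∘ opposite
      ; edge-above   = edge-above above ∘ opposite }

    above-cons : ∀ {j r a g} {P : Path r} {a∈ p∈ a∉ g∉} → Above j P →
                 (∀ {u} → u ∈ E g → j ℕ.≤ dist u) → Above j (cons a g P a∈ p∈ a∉ g∉)
    above-cons {a∈ = a∈} above g-above = record
      { vertex-above = λ { zero → g-above a∈ ; (suc i) → vertex-above above i }
      ; edge-above   = λ { zero → g-above ; (suc i) → edge-above above i } }

    record Arch (j r : ℕ) : Set where
      field
        path        : Path r
        above       : Above j path
        first-level : dist (first path) ≡ j
        last-level  : dist (last path) ≡ j

    point-arch : ∀ {j x} → dist x ≡ j → Arch j 0
    point-arch {x = x} dx = record
      { path        = point x
      ; above       = record { vertex-above = λ _ → ℕ.≤-reflexive (sym dx) ; edge-above = λ () }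
      ; first-level = dx
      ; last-level  = dx }

    module Descent {j r fp} (A : Arch (suc j) r) (p : ParentEdge j (first (Arch.path A)) fp) where
      open Arch A
      open ParentEdge p

      extended : Path (suc r)
      extended = cons parent fp path parent∈ child∈
                      (above-suc⇒∉ above parent-level) (above-suc⇒edge∉ above parent∈ parent-level)

      extended-above : Above j extended
      extended-above = above-cons (above-weaken above) (adjacent-level child∈ first-level)

      extended-avoids : ∀ {a} → parent ≢ a → dist a ≡ j → ∀ i → vertex extended i ≢ a
      extended-avoids a≢p da zero    = a≢p
      extended-avoids a≢p da (suc i) = above-suc⇒∉ above da i

      extended-avoids-edge : ∀ {a g} → fp ≢ g → a ∈ E g → dist a ≡ j → ∀ i → edge extended i ≢ g
      extended-avoids-edge fp≢g a∈ da zero    = fp≢g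
      extended-avoids-edge fp≢g a∈ da (suc i) = above-suc⇒edge∉ above a∈ da i

    lower-arch : ∀ {j r fp fq} (A : Arch (suc j) r) (p : ParentEdge j (first (Arch.path A)) fp)
                 (q : ParentEdge j (last (Arch.path A)) fq) →
                 fp ≢ fq → ParentEdge.parent p ≢ ParentEdge.parent q → Arch j (suc (suc r))
    lower-arch {fq = fq} A p q fp≢fq cp≢cq = record
      { path        = cons parent fq (reverse extended) parent∈ child∈
                           (extended-avoids cp≢cq parent-level ∘ opposite)
                           (extended-avoids-edge fp≢fq parent∈ parent-level ∘ opposite)
      ; above       = above-cons (above-reverse extended-above)
                                 (adjacent-level child∈ (Arch.last-level A))
      ; first-level = parent-level
      ; last-level  = trans (cong dist (last-reverse extended)) (ParentEdge.parent-level p)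
      }
      where
      open Descent A p
      open ParentEdge q

    module Tree (linear : Linear E) (acyclic : ¬ BergeCycle E) where

      no-split-descent : ∀ {j r fp fq} → (∀ {r} → ¬ Arch j (suc r)) → (A : Arch (suc j) r) →
                         ParentEdge j (first (Arch.path A)) fp → ParentEdge j (last (Arch.path A)) fq →
                         fp ≢ fq → ⊥
      no-split-descent {fq = fq} no-lower A p q fp≢fq with ParentEdge.parent p ≟ᶠ ParentEdge.parent q
      ... | no cp≢cq = no-lower (lower-arch A p q fp≢fq cp≢cq)
      ... | yes cp≡cq =
        no-closed-path linear acyclic extended fq (subst (_∈ E fq) (sym cp≡cq) parent∈) child∈
                       (extended-avoids-edge fp≢fq parent∈ parent-level)
        where
        open Descent A p
        open ParentEdge q

      -- Stepping down from both ends of an arch either closes a Berge cycle (a linearity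
      -- violation when it has only two edges) or yields an arch one level lower; at level 0
      -- both ends would be the root.
      no-arch : ∀ j {r} → ¬ Arch j (suc r)
      no-arch zero A = 0≢1+n (vertex-injective path (trans (dist≡0⇒root first-level)
                                                          (sym (dist≡0⇒root last-level))))
        where open Arch A
      no-arch (suc j) A with parent-edge (Arch.first-level A) | parent-edge (Arch.last-level A)
      ... | fp , p | fq , q with fp ≟ᶠ fq
      ...   | no fp≢fq = no-split-descent (no-arch j) A p q fp≢fq
      ...   | yes refl =
        no-closed-path linear acyclic (Arch.path A) fp (ParentEdge.child∈ p) (ParentEdge.child∈ q)
                       (above-suc⇒edge∉ (Arch.above A) (ParentEdge.parent∈ p) (ParentEdge.parent-level p))

      no-level-tie : ∀ {a b e j} → a ∈ E e → b ∈ E e → a ≢ b → dist a ≡ j → dist b ≡ j →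
                     (∀ {u} → u ∈ E e → j ℕ.≤ dist u) → ⊥
      no-level-tie {a} {b} {e} a∈ b∈ a≢b da db e-above = no-arch _ (record
        { path        = cons a e (point b) a∈ b∈ (λ _ → a≢b ∘ sym) (λ ())
        ; above       = above-cons (Arch.above (point-arch db)) e-above
        ; first-level = da
        ; last-level  = db })

      no-two-parent-edges : ∀ {x j f g} → dist x ≡ suc j →
                            ParentEdge j x f → ParentEdge j x g → f ≢ g → ⊥
      no-two-parent-edges dx = no-split-descent (no-arch _) (point-arch dx)

      non-descending⇒parent-edge : ∀ {x e j} → x ∈ E e → ¬ Descending E γ x e → dist x ≡ suc j →
                                   ParentEdge j x e
      non-descending⇒parent-edge {x} {e} {j} x∈ non-desc dx with any? (λ u → u ∈? E e ×-dec dist u ℕ.≟ j)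
      ... | yes (u , u∈ , du) = record { parent = u ; child∈ = x∈ ; parent∈ = u∈ ; parent-level = du }
      ... | no no-parent = ⊥-elim (non-desc (descending⁺ x∈ lowest))
        where
        e-above : ∀ {u} → u ∈ E e → dist x ℕ.≤ dist u
        e-above {u} u∈ = subst (ℕ._≤ dist u) (sym dx)
          (ℕ.≤∧≢⇒< (adjacent-level x∈ dx u∈) (λ j≡du → no-parent (u , u∈ , sym j≡du)))
        lowest : ∀ u → u ∈ E e → u ≢ x → dist x ℕ.< dist u
        lowest u u∈ u≢x = ℕ.≤∧≢⇒< (e-above u∈)
          (λ dx≡du → no-level-tie x∈ u∈ (u≢x ∘ sym) refl (sym dx≡du) e-above)

      non-descending-unique : ∀ {x e f} → x ∈ E e → x ∈ E f →
                              ¬ Descending E γ x e → ¬ Descending E γ x f → e ≡ f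
      non-descending-unique {x} {e} {f} x∈e x∈f nd-e nd-f with dist x in dx
      ... | zero  = ⊥-elim (nd-e (dist≡0⇒descending dx x∈e))
      ... | suc j = decidable-stable (e ≟ᶠ f)
        (no-two-parent-edges dx (non-descending⇒parent-edge x∈e nd-e dx)
                                (non-descending⇒parent-edge x∈f nd-f dx))

  module Greedy (W : Fin n → ℚ) (W-injective : Injective _≡_ _≡_ W) where

    Blocks : Subset n → Fin n → Fin m → Set
    Blocks S v e = v ∈ E e × (∀ {u} → u ∈ E e → u ≢ v → u ∈ S × W v < W u)

    Blocked : Subset n → Fin n → Set
    Blocked S v = ∃ (Blocks S v)

    Blocked-mono : ∀ {S S′ v} → S ⊆ S′ → Blocked S v → Blocked S′ v
    Blocked-mono S⊆S′ (e , v∈ , blockers) =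
      e , v∈ , λ u∈ u≢v → map₁ S⊆S′ (blockers u∈ u≢v)

    unblocking-vertex : ∀ {I v e} → v ∈ E e → ¬ Blocks I v e →
                        ∃ λ u → u ∈ E e × u ≢ v × ¬ (u ∈ I × W v < W u)
    unblocking-vertex {I} {v} {e} v∈ not-blocks =
      u , decidable-stable (u ∈? E e) (λ u∉ → ¬blocker (⊥-elim ∘ u∉))
        , (λ u≡v → ¬blocker λ _ u≢v → ⊥-elim (u≢v u≡v))
        , (λ blocker → ¬blocker λ _ _ → blocker)
      where
      counterexample = ¬∀⟶∃¬ n _ (λ u → u ∈? E e →-dec ¬? (u ≟ᶠ v) →-dec u ∈? I ×-dec W v ℚ.<? W u)
                             (λ blockers → not-blocks (v∈ , λ {u} → blockers u))
      u = proj₁ counterexample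
      ¬blocker = proj₂ counterexample

    Greatest : (Fin n → Set) → Maybe (Fin n) → Set
    Greatest P nothing  = ∀ x → ¬ P x
    Greatest P (just y) = P y × (∀ {x} → P x → W x ≤ W y)

    Greatest-cong : ∀ {P Q : Fin n → Set} r → (∀ {x} → P x → Q x) → (∀ {x} → Q x → P x) →
                    Greatest P r → Greatest Q r
    Greatest-cong nothing  P⇒Q Q⇒P none           = λ x → none x ∘ Q⇒P
    Greatest-cong (just y) P⇒Q Q⇒P (Py , y-max) = P⇒Q Py , y-max ∘ Q⇒P

    maxBy-greatest : ∀ xs → Greatest (_∈ₗ xs) (maxBy E W xs)
    maxBy-greatest List.[] = λ _ ()
    maxBy-greatest (x List.∷ xs) with maxBy E W xs | maxBy-greatest xs
    ... | nothing | none = here refl , λ { (here refl) → ℚ.≤-refl ; (there z∈) → ⊥-elim (none _ z∈) }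
    ... | just y | y∈ , y-max with W y ℚ.<? W x
    ...   | yes y<x = here refl , λ { (here refl) → ℚ.≤-refl
                                   ; (there z∈) → ℚ.<⇒≤ (ℚ.≤-<-trans (y-max z∈) y<x) }
    ...   | no y≮x  = there y∈ , λ { (here refl) → ℚ.≮⇒≥ y≮x ; (there z∈) → y-max z∈ }

    argmax-greatest : ∀ R → Greatest (_∈ R) (argmax E W R)
    argmax-greatest R = Greatest-cong (argmax E W R)
      (proj₂ ∘ ∈-filter⁻ (_∈? R) {xs = allFin n}) (λ {x} → ∈-filter⁺ (_∈? R) (∈-allFin x))
      (maxBy-greatest (filter (_∈? R) (allFin n)))

    Completes : Subset n → Fin n → Set
    Completes S x = ∃ λ e → E e ⊆ S ∪ ⁅ x ⁆

    ∈-newR⁻ : ∀ {S R v x} → x ∈ newR E S R v → x ∈ R × x ≢ v × ¬ Completes S x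
    ∈-newR⁻ {S} {R} {v} {x} x∈ =
      T-lookup⇒∈ x∈R , toWitnessFalse {a? = x ≟ᶠ v} x≢v
                     , toWitnessFalse {a? = any? λ e → E e ⊆? S ∪ ⁅ x ⁆} free
      where
      x∈R×rest = Equivalence.to T-∧ (∈-tabulate⁻ x∈)
      x∈R = proj₁ x∈R×rest
      x≢v = proj₁ (Equivalence.to T-∧ (proj₂ x∈R×rest))
      free = proj₂ (Equivalence.to T-∧ (proj₂ x∈R×rest))

    ∈-newR⁺ : ∀ {S R v x} → x ∈ R → x ≢ v → ¬ Completes S x → x ∈ newR E S R v
    ∈-newR⁺ {S} {R} {v} {x} x∈R x≢v free = ∈-tabulate⁺ (Equivalence.from T-∧
      (∈⇒T-lookup x∈R , Equivalence.from T-∧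
        (fromWitnessFalse {a? = x ≟ᶠ v} x≢v , fromWitnessFalse {a? = any? λ e → E e ⊆? S ∪ ⁅ x ⁆} free)))

    ∉-newR : ∀ {S R v x} → x ∈ R → x ∉ newR E S R v → x ≡ v ⊎ Completes S x
    ∉-newR {S} {v = v} {x} x∈R x∉ with x ≟ᶠ v | any? (λ e → E e ⊆? S ∪ ⁅ x ⁆)
    ... | yes x≡v | _              = inj₁ x≡v
    ... | no _    | yes completes  = inj₂ completes
    ... | no x≢v  | no free        = contradiction (∈-newR⁺ x∈R x≢v free) x∉

    record Invariant (S R : Subset n) : Set where
      field
        selected-heavier   : ∀ {s r} → s ∈ S → r ∈ R → W r < W s
        remaining-addable  : ∀ {w} → w ∈ R → ∀ e → ¬ E e ⊆ S ∪ ⁅ w ⁆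
        selected-unblocked : ∀ {s} → s ∈ S → ¬ Blocked S s
        discarded-blocked  : ∀ {w} → w ∉ S → w ∉ R → Blocked S w

    record Stable (I : Subset n) : Set where
      field
        selected-unblocked : ∀ {v} → v ∈ I → ¬ Blocked I v
        discarded-blocked  : ∀ {v} → v ∉ I → Blocked I v

    initial-invariant : EdgesNontrivial E → Invariant ∅ ⊤
    initial-invariant nontrivial = record
      { selected-heavier   = ⊥-elim ∘ ∉⊥
      ; remaining-addable  = λ {w} _ e e⊆ → ℕ.<⇒≱ (nontrivial e)
          (ℕ.≤-trans (p⊆q⇒∣p∣≤∣q∣ ([ ⊥-elim ∘ ∉⊥ , id ]′ ∘ x∈p∪q⁻ ∅ ⁅ w ⁆ ∘ e⊆))
                     (ℕ.≤-reflexive (∣⁅x⁆∣≡1 w)))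
      ; selected-unblocked = ⊥-elim ∘ ∉⊥
      ; discarded-blocked  = λ _ w∉ → contradiction ∈⊤ w∉
      }

    exhausted-stable : ∀ {S R} → Invariant S R → (∀ x → x ∉ R) → Stable S
    exhausted-stable inv empty = record
      { selected-unblocked = selected-unblocked
      ; discarded-blocked  = λ w∉ → discarded-blocked w∉ (empty _) }
      where open Invariant inv

    module Step {S R v} (inv : Invariant S R) (v∈R : v ∈ R) (v-max : ∀ {x} → x ∈ R → W x ≤ W v) where
      open Invariant inv

      S′ = S ∪ ⁅ v ⁆
      R′ = newR E S′ R v

      v∈S′ : v ∈ S′
      v∈S′ = q⊆p∪q S ⁅ v ⁆ (x∈⁅x⁆ v)

      ∈R′⁻ : ∀ {x} → x ∈ R′ → x ∈ R × x ≢ v × ¬ Completes S′ x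
      ∈R′⁻ = ∈-newR⁻ {S′} {R} {v}

      selected-heavier′ : ∀ {s r} → s ∈ S′ → r ∈ R′ → W r < W s
      selected-heavier′ s∈ r∈ with ∈R′⁻ r∈ | ∈-∪⁅⁆⁻ s∈
      ... | r∈R , _   , _ | inj₁ s∈S = selected-heavier s∈S r∈R
      ... | r∈R , r≢v , _ | inj₂ refl = weight-< W-injective (v-max r∈R) r≢v

      remaining-addable′ : ∀ {w} → w ∈ R′ → ∀ e → ¬ E e ⊆ S′ ∪ ⁅ w ⁆
      remaining-addable′ w∈ e e⊆ = proj₂ (proj₂ (∈R′⁻ w∈)) (e , e⊆)

      selected-unblocked′ : ∀ {s} → s ∈ S′ → ¬ Blocked S′ s
      selected-unblocked′ s∈ (e , s∈e , blockers) with ∈-∪⁅⁆⁻ s∈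
      ... | inj₂ refl = remaining-addable v∈R e e⊆S′
        where
        e⊆S′ : E e ⊆ S′
        e⊆S′ {u} u∈ with u ≟ᶠ v
        ... | yes refl = v∈S′
        ... | no u≢v   = proj₁ (blockers u∈ u≢v)
      ... | inj₁ s∈S = selected-unblocked s∈S (e , s∈e , λ u∈ u≢s → blocker-in-S (blockers u∈ u≢s))
        where
        blocker-in-S : ∀ {u} → u ∈ S′ × W _ < W u → u ∈ S × W _ < W u
        blocker-in-S (u∈S′ , s<u) with ∈-∪⁅⁆⁻ u∈S′
        ... | inj₁ u∈S = u∈S , s<u
        ... | inj₂ refl = ⊥-elim (ℚ.<-asym s<u (selected-heavier s∈S v∈R))

      discarded-blocked′ : ∀ {w} → w ∉ S′ → w ∉ R′ → Blocked S′ w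
      discarded-blocked′ {w} w∉S′ w∉R′ with w ∈? R
      ... | no w∉R = Blocked-mono (p⊆p∪q ⁅ v ⁆) (discarded-blocked (w∉S′ ∘ p⊆p∪q ⁅ v ⁆) w∉R)
      ... | yes w∈R with ∉-newR {S′} {R} {v} w∈R w∉R′
      ...   | inj₁ refl = contradiction v∈S′ w∉S′
      ...   | inj₂ (e , e⊆) = e , w∈e , blockers
        where
        w∈e : w ∈ E e
        w∈e = decidable-stable (w ∈? E e) λ w∉e → remaining-addable v∈R e λ u∈ →
                [ id , (λ u≡w → contradiction (subst (_∈ E e) u≡w u∈) w∉e) ]′ (∈-∪⁅⁆⁻ (e⊆ u∈))
        blockers : ∀ {u} → u ∈ E e → u ≢ w → u ∈ S′ × W w < W u
        blockers u∈ u≢w with ∈-∪⁅⁆⁻ (e⊆ u∈)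
        ... | inj₂ u≡w = contradiction u≡w u≢w
        ... | inj₁ u∈S′ with ∈-∪⁅⁆⁻ u∈S′
        ...   | inj₁ u∈S = u∈S′ , selected-heavier u∈S w∈R
        ...   | inj₂ refl =
          u∈S′ , weight-< W-injective (v-max w∈R) (λ w≡v → w∉S′ (subst (_∈ S′) (sym w≡v) v∈S′))

      invariant′ : Invariant S′ R′
      invariant′ = record
        { selected-heavier   = selected-heavier′
        ; remaining-addable  = remaining-addable′
        ; selected-unblocked = selected-unblocked′
        ; discarded-blocked  = discarded-blocked′
        }

      R′⊂R : ∣ R′ ∣ ℕ.< ∣ R ∣
      R′⊂R = p⊂q⇒∣p∣<∣q∣ (proj₁ ∘ ∈R′⁻ , v , v∈R , λ v∈R′ → proj₁ (proj₂ (∈R′⁻ v∈R′)) refl)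

    greedy-stable : ∀ f {S R} → Invariant S R → ∣ R ∣ ℕ.≤ f → Stable (greedy E W f S R)
    greedy-stable zero inv ∣R∣≤0 =
      exhausted-stable inv λ x x∈ → ℕ.n≮0 (ℕ.<-≤-trans (x∈p⇒∣p-x∣<∣p∣ x∈) ∣R∣≤0)
    greedy-stable (suc f) {S} {R} inv ∣R∣≤f with argmax E W R | argmax-greatest R
    ... | nothing | none         = exhausted-stable inv none
    ... | just v  | v∈R , v-max  =
      greedy-stable f invariant′ (s≤s⁻¹ (ℕ.<-≤-trans R′⊂R ∣R∣≤f))
      where open Step inv v∈R v-max

    𝓘-stable : EdgesNontrivial E → Stable (𝓘 E W)
    𝓘-stable nontrivial = greedy-stable n (initial-invariant nontrivial) (ℕ.≤-reflexive (∣⊤∣≡n n))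

  module Bonus (γ : Fin n) (connected : Connected E) (W : Fin n → ℚ)
               (W-positive : ∀ v → 0ℚ < W v) (W-injective : Injective _≡_ _≡_ W) where

    open Levels γ connected

    bonus-cond? : ∀ S v → Dec (BonusCond E γ W S v)
    bonus-cond? S v =
      all? λ i → descending? v i →-dec any? λ u → u ∈? E i ×-dec ¬? (u ≟ᶠ v) ×-dec S u ℚ.<? W v

    BonusCond-map : ∀ {S S′ v} → (∀ {u} → u ≢ v → S u < W v → S′ u < W v) →
                    BonusCond E γ W S v → BonusCond E γ W S′ v
    BonusCond-map below cond i desc with cond i desc
    ... | u , u∈ , u≢v , Su<Wv = u , u∈ , u≢v , below u≢v Su<Wv

    -- Whether S u < W v holds for a lighter u does not depend on S once S u ∈ {0, W u}, so
    -- masking lighter vertices makes the defining recursion depend on heavier vertices only.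
    mask : Fin n → (Fin n → ℚ) → Fin n → ℚ
    mask v S u = if does (W v ℚ.<? W u) then S u else 0ℚ

    bonus-step : (Fin n → ℚ) → Fin n → ℚ
    bonus-step S v = if does (bonus-cond? (mask v S) v) then W v else 0ℚ

    mask-cong : ∀ {S S′ v} → (∀ {u} → W v < W u → S u ≡ S′ u) → ∀ u → mask v S u ≡ mask v S′ u
    mask-cong {v = v} agree u = if-does-cong (W v ℚ.<? W u) agree

    bonus-step-guarded : ∀ {S S′} v → (∀ {u} → W v < W u → S u ≡ S′ u) →
                         bonus-step S v ≡ bonus-step S′ v
    bonus-step-guarded {S} {S′} v agree = cong (λ b → if b then W v else 0ℚ)
      (does-⇔ (mk⇔ (BonusCond-map λ {u} _ → subst (_< W v) (mask-cong agree u))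
                   (BonusCond-map λ {u} _ → subst (_< W v) (sym (mask-cong agree u))))
              (bonus-cond? (mask v S) v) (bonus-cond? (mask v S′) v))

    bonus-exists : Σ (Fin n → ℚ) (IsBonus E γ W)
    bonus-exists = S , is-bonus
      where
      fixpoint = guarded-fixpoint (heavier-wellFounded W) (λ u v → W v ℚ.<? W u) 0ℚ
                                  bonus-step bonus-step-guarded
      S = proj₁ fixpoint
      S-fixed = proj₂ fixpoint

      lighter-below : ∀ {u v} → W u < W v → S u < W v
      lighter-below {u} {v} u<v = subst (_< W v) (sym (S-fixed u))
        (if-does-elim (_< W v) (bonus-cond? (mask u S) u) (λ _ → u<v) (λ _ → W-positive v))

      to-mask : ∀ {v u} → u ≢ v → S u < W v → mask v S u < W v
      to-mask {v} {u} _ Su<Wv = if-does-elim (_< W v) (W v ℚ.<? W u) (λ _ → Su<Wv) (λ _ → W-positive v)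

      from-mask : ∀ {v u} → u ≢ v → mask v S u < W v → S u < W v
      from-mask {v} {u} u≢v = if-does-elim (λ q → q < W v → S u < W v) (W v ℚ.<? W u)
        (λ _ → id) (λ v≮u _ → lighter-below (weight-< W-injective (ℚ.≮⇒≥ v≮u) u≢v))

      is-bonus : IsBonus E γ W S
      is-bonus v =
        (λ cond → trans (S-fixed v) (cong (λ b → if b then W v else 0ℚ)
                    (dec-true (bonus-cond? (mask v S) v) (BonusCond-map to-mask cond)))) ,
        (λ ¬cond → trans (S-fixed v) (cong (λ b → if b then W v else 0ℚ)
                    (dec-false (bonus-cond? (mask v S) v) (¬cond ∘ BonusCond-map from-mask))))

    module Agreement (nontrivial : EdgesNontrivial E) (linear : Linear E) (acyclic : ¬ BergeCycle E)
                     (S : Fin n → ℚ) (bonus : IsBonus E γ W S) where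

      open Tree linear acyclic
      open Greedy W W-injective
      open Stable (𝓘-stable nontrivial)

      I : Subset n
      I = 𝓘 E W

      -- The bonus condition ignores the one non-descending edge of v (its edge towards the
      -- root), so it can only match selection by 𝓘 when that edge does not block v.
      UnblockedFromAbove : Fin n → Set
      UnblockedFromAbove v = ∀ e → ¬ Descending E γ v e → ¬ Blocks I v e

      root-unblocked-from-above : UnblockedFromAbove γ
      root-unblocked-from-above e nd (γ∈e , _) = nd (dist≡0⇒descending dist-root γ∈e)

      Agrees : Fin n → Set
      Agrees v = (v ∈ I → BonusCond E γ W S v) × (BonusCond E γ W S v → UnblockedFromAbove v → v ∈ I)

      selected⇒cond : ∀ {v} → (∀ {u} → W v < W u → Agrees u) → v ∈ I → BonusCond E γ W S v
      selected⇒cond {v} ih v∈I i desc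
        with unblocking-vertex (proj₁ desc) (λ blocks → selected-unblocked v∈I (i , blocks))
      ... | u , u∈ , u≢v , ¬blocker = u , u∈ , u≢v , below
        where
        unblocked-from-above : W v < W u → UnblockedFromAbove u
        unblocked-from-above v<u e nd (u∈e , blockers)
          with non-descending-unique u∈e u∈ nd (descending-unique desc u∈ u≢v)
        ... | refl = ℚ.<-asym v<u (proj₂ (blockers (proj₁ desc) (u≢v ∘ sym)))

        below : S u < W v
        below with bonus-cond? S u | ℚ.<-cmp (W u) (W v)
        ... | no ¬cond | _            = subst (_< W v) (sym (proj₂ (bonus u) ¬cond)) (W-positive v)
        ... | yes cond | tri< u<v _ _ = subst (_< W v) (sym (proj₁ (bonus u) cond)) u<v
        ... | yes cond | tri≈ _ u≡v _ = contradiction (W-injective u≡v) u≢v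
        ... | yes cond | tri> _ _ v<u =
          contradiction (proj₂ (ih v<u) cond (unblocked-from-above v<u) , v<u) ¬blocker

      cond⇒selected : ∀ {v} → (∀ {u} → W v < W u → Agrees u) →
                      BonusCond E γ W S v → UnblockedFromAbove v → v ∈ I
      cond⇒selected {v} ih cond unblocked-from-above =
        decidable-stable (v ∈? I) (not-blocked ∘ discarded-blocked)
        where
        not-blocked : ¬ Blocked I v
        not-blocked (e , v∈e , blockers) with descending? v e
        ... | no nd    = unblocked-from-above e nd (v∈e , blockers)
        ... | yes desc with cond e desc
        ...   | u , u∈ , u≢v , Su<Wv with blockers u∈ u≢v
        ...     | u∈I , v<u =
          ℚ.<-asym v<u (subst (_< W v) (proj₁ (bonus u) (proj₁ (ih v<u) u∈I)) Su<Wv)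

      agrees : ∀ v → Agrees v
      agrees = All.wfRec (heavier-wellFounded W) _ Agrees
                 λ v ih → selected⇒cond ih , cond⇒selected ih

      bonus-root : S γ ≡ W γ * indicator γ I
      bonus-root with γ ∈? I
      ... | yes γ∈I = trans (proj₁ (bonus γ) (proj₁ (agrees γ) γ∈I)) (sym (ℚ.*-identityʳ (W γ)))
      ... | no γ∉I  =
        trans (proj₂ (bonus γ) λ cond → γ∉I (proj₂ (agrees γ) cond root-unblocked-from-above))
              (sym (ℚ.*-zeroʳ (W γ)))

lemma5 : ∀ {n m : ℕ} (E : Hypergraph n m) (γ : Fin n) (W : Fin n → ℚ) →
    IsHypertree E →
    (∀ v → 0ℚ < W v) → Injective _≡_ _≡_ W →
    Σ (Fin n → ℚ) (IsBonus E γ W) ×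
    (∀ S → IsBonus E γ W S → S γ ≡ W γ * indicator γ (𝓘 E W))
lemma5 E γ W (nontrivial , linear , connected , acyclic) W-positive W-injective =
  bonus-exists , Agreement.bonus-root nontrivial linear acyclic
  where open Bonus E γ connected W W-positive W-injective
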